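{- Let $J$ be a finite set and $(V_j)_{j\in J}$ finite non-empty sets. Let $e\subseteq J$, let $E_e\in\mathcal{A}_e$, and for each $f\in\partial e$ let $\mathcal{B}_f\subseteq\mathcal{A}_f$ be a $\sigma$-algebra such that $$\Delta_e\Big(E_e\,\Big|\,\bigvee_{f\in\partial e}\mathcal{B}_f\Big)\geq\varepsilon$$ for some $\varepsilon>0$. Then for every $f\in\partial e$ there exists a $\sigma$-algebra $\mathcal{B}'_f$ with $\mathcal{B}_f\subseteq\mathcal{B}'_f\subseteq\mathcal{A}_f$ such that $$\mathrm{complex}(\mathcal{B}'_f)\leq\mathrm{complex}(\mathcal{B}_f)+1$$ and $$\mathcal{E}_{E_e}\Big(\bigvee_{f\in\partial e}\mathcal{B}'_f\Big)\geq\mathcal{E}_{E_e}\Big(\bigvee_{f\in\partial e}\mathcal{B}_f\Big)+\varepsilon^2.$$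
   Context: For $e\subseteq J$ write $V_e:=\prod_{j\in e}V_j$ and $\pi_e:V_J\to V_e$ for the projection. A $\sigma$-algebra on $V_J$ is a collection of subsets of $V_J$ containing $\emptyset,V_J$ and closed under unions, intersections and complements; its atoms are its minimal non-empty members. $\mathcal{A}_e:=\{\pi_e^{ -1}(E):E\subseteq V_e\}$. $\bigvee_i\mathcal{B}_i$ is the smallest $\sigma$-algebra containing all $\mathcal{B}_i$ (the empty join is $\{\emptyset,V_J\}$). For $g:V_J\to\mathbb{R}$, $\mathbf{E}(g):=\frac1{|V_J|}\sum_{x\in V_J}g(x)$, and $\mathbf{E}(g|\mathcal{B})(x)$ is the average of $g$ over the atom of $\mathcal{B}$ containing $x$. $\mathrm{complex}(\mathcal{B})$ is the least number of subsets of $V_J$ generating $\mathcal{B}$. For $E\subseteq V_J$, the $E$-energy is $\mathcal{E}_E(\mathcal{B}):=\mathbf{E}(|\mathbf{E}(1_E|\mathcal{B})|^2)$. The skeleton of $e$ is $\partial e:=\{f\subsetneq e:|f|=|e|-1\}$. The $e$-discrepancy of $E\subseteq V_J$ relative to $\mathcal{B}$ is $$\Delta_e(E|\mathcal{B}):=\sup\Big|\mathbf{E}\Big((1_E-\mathbf{E}(1_E|\mathcal{B}))\prod_{f\in\partial e}1_{E_f}\Big)\Big|,$$ the supremum over all families $(E_f)_{f\in\partial e}$ with $E_f\in\mathcal{A}_f$.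
   Formalization: The parameter ε is taken to be a positive rational number. -}

module Defs where

open import Data.Nat as ℕ using (ℕ; zero; suc; _∸_; NonZero)
open import Data.Fin using (Fin)
open import Data.Fin.Subset using (Subset; _∈_) renaming (∣_∣ to size)
open import Data.Fin.Subset.Properties using (_⊂?_)
open import Data.Vec using ([]; _∷_)
open import Data.Bool using (Bool; true; false; if_then_else_; _∧_; T)
open import Data.List as List using (List; []; _∷_; concatMap; map; length)
open import Data.List.Base using (allFin)
open import Data.Product using (Σ; ∃; _×_; _,_; proj₁)
open import Data.Sum using (_⊎_)
open import Data.Integer using (+_)
open import Data.Rational as ℚ using (ℚ; 0ℚ; 1ℚ; _+_; _*_; _-_; ∣_∣; _≤_)
open import Relation.Nullary.Decidable using (⌊_⌋)
open import Relation.Binary.PropositionalEquality using (_≡_)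
open import Function using (_∘_)

-- Setting: J = Fin n, V_j = Fin (V j).  Points of V_J are dependent
-- functions; subsets of V_J are Bool-valued predicates on points.

module Setting (n : ℕ) (V : Fin n → ℕ) where

  Point : Set
  Point = (j : Fin n) → Fin (V j)

  PSet : Set
  PSet = Point → Bool

  _≗ₛ_ : PSet → PSet → Set
  A ≗ₛ B = ∀ x → A x ≡ B x

  ∅ₛ fullₛ : PSet
  ∅ₛ _ = false
  fullₛ _ = true

  _∪ₛ_ _∩ₛ_ : PSet → PSet → PSet
  (A ∪ₛ B) x = if A x then true else B x
  (A ∩ₛ B) x = A x ∧ B x

  compₛ : PSet → PSet
  compₛ A x = if A x then false else true

  _⊆ₛ_ : PSet → PSet → Set
  A ⊆ₛ B = ∀ x → A x ≡ true → B x ≡ true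

  Nonempty : PSet → Set
  Nonempty A = ∃ λ x → A x ≡ true

  V[_] : Subset n → Set
  V[ e ] = (j : Fin n) → j ∈ e → Fin (V j)

  π : (e : Subset n) → Point → V[ e ]
  π e x j _ = x j

  In𝒜 : Subset n → PSet → Set
  In𝒜 e A = ∃ λ (E : V[ e ] → Bool) → ∀ x → A x ≡ E (π e x)

  record SigmaAlg : Set₁ where
    field
      mem   : PSet → Set
      resp  : ∀ {A B} → A ≗ₛ B → mem A → mem B
      mem∅  : mem ∅ₛ
      memV  : mem fullₛ
      mem∪  : ∀ {A B} → mem A → mem B → mem (A ∪ₛ B)
      mem∩  : ∀ {A B} → mem A → mem B → mem (A ∩ₛ B)
      memᶜ  : ∀ {A} → mem A → mem (compₛ A)
  open SigmaAlg public

  _⊑_ : SigmaAlg → SigmaAlg → Set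
  B ⊑ C = ∀ A → mem B A → mem C A

  _⊑𝒜_ : SigmaAlg → Subset n → Set
  B ⊑𝒜 e = ∀ A → mem B A → In𝒜 e A

  data Gen (G : PSet → Set) : PSet → Set where
    gen   : ∀ {A} → G A → Gen G A
    g-resp : ∀ {A B} → A ≗ₛ B → Gen G A → Gen G B
    g∅    : Gen G ∅ₛ
    gV    : Gen G fullₛ
    g∪    : ∀ {A B} → Gen G A → Gen G B → Gen G (A ∪ₛ B)
    g∩    : ∀ {A B} → Gen G A → Gen G B → Gen G (A ∩ₛ B)
    gᶜ    : ∀ {A} → Gen G A → Gen G (compₛ A)

  σ[_] : (PSet → Set) → SigmaAlg
  σ[ G ] = record { mem = Gen G ; resp = g-resp ; mem∅ = g∅ ; memV = gV
                  ; mem∪ = g∪ ; mem∩ = g∩ ; memᶜ = gᶜ }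

  ⋁ : (I : Set) → (I → SigmaAlg) → SigmaAlg
  ⋁ I B = σ[ (λ A → ∃ λ i → mem (B i) A) ]

  GeneratedBy : SigmaAlg → ℕ → Set
  GeneratedBy B k = ∃ λ (gs : Fin k → PSet) →
    ∀ A → (mem B A → mem σ[ (λ C → ∃ λ i → C ≡ gs i) ] A)
        × (mem σ[ (λ C → ∃ λ i → C ≡ gs i) ] A → mem B A)

  Complex : SigmaAlg → ℕ → Set
  Complex B c = GeneratedBy B c × (∀ k → GeneratedBy B k → c ℕ.≤ k)

  points : (m : ℕ) (W : Fin m → ℕ) → List ((j : Fin m) → Fin (W j))
  points zero W = (λ ()) ∷ []
  points (suc m) W =
    concatMap (λ a → map (λ p → λ { Fin.zero → a ; (Fin.suc j) → p j })
                         (points m (W ∘ Fin.suc)))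
              (allFin (W Fin.zero))

  allPoints : List Point
  allPoints = points n V

  sumℚ : List ℚ → ℚ
  sumℚ = List.foldr _+_ 0ℚ

  prodℚ : List ℚ → ℚ
  prodℚ = List.foldr _*_ 1ℚ

  divℕ : ℚ → ℕ → ℚ
  divℕ q zero = 0ℚ
  divℕ q (suc k) = q * ((+ 1) ℚ./ suc k)

  𝐄 : (Point → ℚ) → ℚ
  𝐄 g = divℕ (sumℚ (map g allPoints)) (length allPoints)

  𝟙 : PSet → Point → ℚ
  𝟙 A x = if A x then 1ℚ else 0ℚ

  avgOver : PSet → (Point → ℚ) → ℚ
  avgOver A g = divℕ (sumℚ (map (λ x → 𝟙 A x * g x) allPoints))
                     (length (List.filter (λ x → T? (A x)) allPoints))
    where
      open import Relation.Nullary using (Dec; yes; no)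
      T? : (b : Bool) → Dec (T b)
      T? true = yes _
      T? false = no (λ ())

  IsAtom : SigmaAlg → PSet → Set
  IsAtom B A = mem B A × Nonempty A
             × (∀ C → mem B C → Nonempty C → C ⊆ₛ A → A ⊆ₛ C)

  AtomMap : SigmaAlg → (Point → PSet) → Set
  AtomMap B α = ∀ x → IsAtom B (α x) × α x x ≡ true

  -- 𝐄(g | B)(x), computed via an atom map α of B
  condE : (Point → PSet) → (Point → ℚ) → Point → ℚ
  condE α g x = avgOver (α x) g

  energy : (Point → PSet) → PSet → ℚ
  energy α E = 𝐄 (λ x → condE α (𝟙 E) x * condE α (𝟙 E) x)

  isSkel : Subset n → Subset n → Bool
  isSkel e f = ⌊ f ⊂? e ⌋ ∧ (size f ℕ.≡ᵇ (size e ∸ 1))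

  ∂ : Subset n → Set
  ∂ e = Σ (Subset n) (λ f → T (isSkel e f))

  allSubsets : (m : ℕ) → List (Subset m)
  allSubsets zero = [] ∷ []
  allSubsets (suc m) = concatMap (λ s → (false ∷ s) ∷ (true ∷ s) ∷ [])
                                 (allSubsets m)

  skeletonList : Subset n → List (Subset n)
  skeletonList e = List.filter (λ f → T?' (isSkel e f)) (allSubsets n)
    where
      open import Relation.Nullary using (Dec; yes; no)
      T?' : (b : Bool) → Dec (T b)
      T?' true = yes _
      T?' false = no (λ ())

  -- x ↦ ∏_{f ∈ ∂e} 1_{E_f}(x)   (families indexed by all subsets; only
  -- the values on ∂e matter)
  prodSkel : Subset n → (Subset n → PSet) → Point → ℚ
  prodSkel e Ef x = prodℚ (map (λ f → 𝟙 (Ef f) x) (skeletonList e))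

  -- Δ_e(E | B) ≥ ε : the supremum over families (E_f)_{f∈∂e}, E_f ∈ 𝒜_f,
  -- is ≥ ε (a finite supremum, so: attained by some family), where
  -- 𝐄(·|B) is computed with the atom map of B
  DiscrepancyAtLeast : Subset n → PSet → SigmaAlg → ℚ → Set
  DiscrepancyAtLeast e E B ε =
    ∃ λ (α : Point → PSet) → AtomMap B α ×
    ∃ λ (Ef : Subset n → PSet) → (∀ (f : ∂ e) → In𝒜 (proj₁ f) (Ef (proj₁ f))) ×
      (ε ≤ ∣ 𝐄 (λ x → (𝟙 E x - condE α (𝟙 E) x) * prodSkel e Ef x) ∣)

module Submission where

-- Adjoin E_f to ℬ_f, which costs one generator. Write u, u′ for the conditional expectations of 1_E
-- on the old and new joins, and P = ∏ 1_{E_f}. Conditional expectation is computed by averaging over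
-- atoms, a symmetric stochastic kernel, hence self-adjoint. As P is measurable for the new join,
-- ⟨u′ - u, P⟩ = ⟨1_E - u, P⟩, whose absolute value is at least ε; as 0 ≤ P ≤ 1, Cauchy–Schwarz
-- gives ‖u′ - u‖² ≥ ε², and since the old join is coarser, Pythagoras gives ‖u′ - u‖² = ‖u′‖² - ‖u‖².

open import Defs
open import Data.Nat using (ℕ; suc; NonZero)
open import Data.Fin using (Fin)
open import Data.Fin.Subset using (Subset)
open import Data.Product using (∃; _×_; proj₁)
open import Data.Rational using (ℚ; 0ℚ; _<_; _≤_; _+_; _*_)

open import Data.Bool using (Bool; true; false; T; if_then_else_; _∧_)
open import Data.Bool.ListAction using (all)
open import Data.Bool.Properties using (T?; ∧-conicalˡ; ∧-conicalʳ; ⇔→≡)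
open import Data.Fin using () renaming (zero to fzero; suc to fsuc)
import Data.Integer as ℤ
open import Data.Integer.Tactic.RingSolver using (solve-∀)
open import Data.List using (List; []; _∷_; foldr; map; length; filter)
open import Data.List.Membership.Propositional using (_∈_; lose)
open import Data.List.Membership.Propositional.Properties using (∈-filter⁻)
open import Data.List.Properties using (filter-≐; filter-some; map-cong-local)
open import Data.List.Relation.Unary.All using (tabulate)
open import Data.List.Relation.Unary.Any using (here; there)
open import Data.Nat using (zero)
import Data.Nat as ℕ
open import Data.Nat.Coprimality using (1-coprimeTo)
open import Data.Product using (_,_; proj₂)
open import Data.Rational using (1ℚ; _-_; -_; ∣_∣; _/_; 1/_; nonNegative)
open import Data.Rational.Literals using (fromℤ)
open import Data.Rational.Properties
open import Data.Rational.Solver using (module +-*-Solver)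
open import Data.Rational.Unnormalised using (*≡*)
import Data.Rational.Unnormalised.Properties as ℚᵘ
open import Data.Sum using (_⊎_; inj₁; inj₂)
open import Data.Unit using (tt)
open import Function using (id; _∘_)
open import Function.Bundles using (mk⇔)
open import Relation.Binary.PropositionalEquality hiding (resp)

open +-*-Solver using (solve; _:+_; _:*_; _:-_; :-_; _:=_; con)

𝟏 : Bool → ℚ
𝟏 b = if b then 1ℚ else 0ℚ

-- By recursion, so that it agrees definitionally with iterated sums of 1ℚ.
fromℕ : ℕ → ℚ
fromℕ zero    = 0ℚ
fromℕ (suc k) = 1ℚ + fromℕ k

fromℕ≡fromℤ : ∀ k → fromℕ k ≡ fromℤ (ℤ.+ k)
fromℕ≡fromℤ zero    = refl
fromℕ≡fromℤ (suc k) = trans (cong (1ℚ +_) (fromℕ≡fromℤ k))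
  (toℚᵘ-injective (ℚᵘ.≃-trans (toℚᵘ-homo-+ 1ℚ (fromℤ (ℤ.+ k))) (*≡* (cross (ℤ.+ k)))))
  where
  cross : ∀ i → (ℤ.+ 1 ℤ.* ℤ.+ 1 ℤ.+ i ℤ.* ℤ.+ 1) ℤ.* ℤ.+ 1 ≡ (ℤ.+ 1 ℤ.+ i) ℤ.* (ℤ.+ 1 ℤ.* ℤ.+ 1)
  cross = solve-∀

fromℕ-*-inverse : ∀ k → fromℕ (suc k) * (ℤ.+ 1 / suc k) ≡ 1ℚ
fromℕ-*-inverse k = begin
  fromℕ (suc k) * (ℤ.+ 1 / suc k)  ≡⟨ cong₂ _*_ (fromℕ≡fromℤ (suc k)) (normalize-coprime (1-coprimeTo (suc k))) ⟩
  q * 1/ q                       ≡⟨ *-inverseʳ q ⟩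
  1ℚ                             ∎
  where
  open ≡-Reasoning
  q = fromℤ (ℤ.+ suc k)

∣p∣*∣p∣≡p*p : ∀ p → ∣ p ∣ * ∣ p ∣ ≡ p * p
∣p∣*∣p∣≡p*p p with ∣p∣≡p∨∣p∣≡-p p
... | inj₁ ∣p∣≡p  rewrite ∣p∣≡p = refl
... | inj₂ ∣p∣≡-p rewrite ∣p∣≡-p = solve 1 (λ x → (:- x) :* (:- x) := x :* x) refl p

square-mono : ∀ {p q} → 0ℚ ≤ p → p ≤ q → p * p ≤ q * q
square-mono {p} {q} 0≤p p≤q = ≤-trans (*-monoˡ-≤-nonNeg p {{nonNegative 0≤p}} p≤q)
                                      (*-monoʳ-≤-nonNeg q {{nonNegative (≤-trans 0≤p p≤q)}} p≤q)

square-≤-∣∣ : ∀ {p q} → 0ℚ ≤ p → p ≤ ∣ q ∣ → p * p ≤ q * q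
square-≤-∣∣ {p} {q} 0≤p p≤∣q∣ = subst (p * p ≤_) (∣p∣*∣p∣≡p*p q) (square-mono 0≤p p≤∣q∣)

square-nonneg : ∀ p → 0ℚ ≤ p * p
square-nonneg p = subst (0ℚ ≤_) (∣p∣*∣p∣≡p*p p) (square-mono ≤-refl (0≤∣p∣ p))

𝟏*𝟏≤1 : ∀ b → 𝟏 b * 𝟏 b ≤ 1ℚ
𝟏*𝟏≤1 true  = ≤-refl
𝟏*𝟏≤1 false = nonNegative⁻¹ 1ℚ

∏-𝟏 : ∀ {X : Set} (p : X → Bool) (xs : List X) → foldr _*_ 1ℚ (map (𝟏 ∘ p) xs) ≡ 𝟏 (all p xs)
∏-𝟏 p []       = refl
∏-𝟏 p (x ∷ xs) with p x
... | true  = trans (*-identityˡ _) (∏-𝟏 p xs)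
... | false = *-zeroˡ (foldr _*_ 1ℚ (map (𝟏 ∘ p) xs))

𝟏-*-cong : ∀ b {c c′} → (b ≡ true → c ≡ c′) → 𝟏 b * c ≡ 𝟏 b * c′
𝟏-*-cong true  c≡c′       = cong (1ℚ *_) (c≡c′ refl)
𝟏-*-cong false {c} {c′} _ = trans (*-zeroˡ c) (sym (*-zeroˡ c′))

∑ : {X : Set} → List X → (X → ℚ) → ℚ
∑ xs f = foldr _+_ 0ℚ (map f xs)

module _ {X : Set} where

  ∑-cong : ∀ (xs : List X) {f g : X → ℚ} → (∀ x → x ∈ xs → f x ≡ g x) → ∑ xs f ≡ ∑ xs g
  ∑-cong []       f≡g = refl
  ∑-cong (x ∷ xs) f≡g = cong₂ _+_ (f≡g x (here refl)) (∑-cong xs (λ y y∈xs → f≡g y (there y∈xs)))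

  ∑-+ : ∀ (xs : List X) (f g : X → ℚ) → ∑ xs (λ x → f x + g x) ≡ ∑ xs f + ∑ xs g
  ∑-+ []       f g = refl
  ∑-+ (x ∷ xs) f g = trans (cong (f x + g x +_) (∑-+ xs f g))
    (solve 4 (λ a b c d → (a :+ b) :+ (c :+ d) := (a :+ c) :+ (b :+ d)) refl (f x) (g x) (∑ xs f) (∑ xs g))

  ∑-*ˡ : ∀ (xs : List X) (c : ℚ) (f : X → ℚ) → ∑ xs (λ x → c * f x) ≡ c * ∑ xs f
  ∑-*ˡ []       c f = sym (*-zeroʳ c)
  ∑-*ˡ (x ∷ xs) c f = trans (cong (c * f x +_) (∑-*ˡ xs c f)) (sym (*-distribˡ-+ c (f x) (∑ xs f)))

  ∑-*ʳ : ∀ (xs : List X) (f : X → ℚ) (c : ℚ) → ∑ xs (λ x → f x * c) ≡ ∑ xs f * c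
  ∑-*ʳ []       f c = sym (*-zeroˡ c)
  ∑-*ʳ (x ∷ xs) f c = trans (cong (f x * c +_) (∑-*ʳ xs f c)) (sym (*-distribʳ-+ c (f x) (∑ xs f)))

  ∑-mono : ∀ (xs : List X) {f g : X → ℚ} → (∀ x → f x ≤ g x) → ∑ xs f ≤ ∑ xs g
  ∑-mono []       f≤g = ≤-refl
  ∑-mono (x ∷ xs) f≤g = +-mono-≤ (f≤g x) (∑-mono xs f≤g)

  ∑-0 : ∀ (xs : List X) → ∑ xs (λ _ → 0ℚ) ≡ 0ℚ
  ∑-0 []       = refl
  ∑-0 (x ∷ xs) = trans (+-identityˡ _) (∑-0 xs)

  ∑-1 : ∀ (xs : List X) → ∑ xs (λ _ → 1ℚ) ≡ fromℕ (length xs)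
  ∑-1 []       = refl
  ∑-1 (x ∷ xs) = cong (1ℚ +_) (∑-1 xs)

  ∑-𝟏 : ∀ (xs : List X) (p : X → Bool) → ∑ xs (λ x → 𝟏 (p x)) ≡ fromℕ (length (filter (T? ∘ p) xs))
  ∑-𝟏 []       p = refl
  ∑-𝟏 (x ∷ xs) p with p x
  ... | true  = cong (1ℚ +_) (∑-𝟏 xs p)
  ... | false = trans (+-identityˡ _) (∑-𝟏 xs p)

∑-swap : ∀ {X Y : Set} (xs : List X) (ys : List Y) (f : X → Y → ℚ) →
         ∑ xs (λ x → ∑ ys (f x)) ≡ ∑ ys (λ y → ∑ xs (λ x → f x y))
∑-swap []       ys f = sym (∑-0 ys)
∑-swap (x ∷ xs) ys f = trans (cong (∑ ys (f x) +_) (∑-swap xs ys f))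
  (sym (∑-+ ys (f x) (λ y → ∑ xs (λ x′ → f x′ y))))

-- For K the averaging kernel of a partition this is 𝐄(𝐄(g | ℬ) h) = 𝐄(g h) for ℬ-measurable h.
∑-kernel-adjoint : ∀ {X : Set} (xs : List X) (K : X → X → ℚ) (g h : X → ℚ) →
  (∀ x y → K x y ≡ K y x) → (∀ y → y ∈ xs → ∑ xs (K y) ≡ 1ℚ) →
  (∀ x y → K x y * h x ≡ K x y * h y) →
  ∑ xs (λ x → ∑ xs (λ y → K x y * g y) * h x) ≡ ∑ xs (λ y → g y * h y)
∑-kernel-adjoint xs K g h K-sym K-rows K-h = begin
  ∑ xs (λ x → ∑ xs (λ y → K x y * g y) * h x)  ≡⟨ ∑-cong xs (λ x _ → sym (∑-*ʳ xs (λ y → K x y * g y) (h x))) ⟩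
  ∑ xs (λ x → ∑ xs (λ y → K x y * g y * h x))  ≡⟨ ∑-cong xs (λ x _ → ∑-cong xs (λ y _ → transpose x y)) ⟩
  ∑ xs (λ x → ∑ xs (λ y → g y * h y * K y x))  ≡⟨ ∑-swap xs xs _ ⟩
  ∑ xs (λ y → ∑ xs (λ x → g y * h y * K y x))  ≡⟨ ∑-cong xs (λ y y∈xs → row y y∈xs) ⟩
  ∑ xs (λ y → g y * h y)                       ∎
  where
  open ≡-Reasoning
  transpose : ∀ x y → K x y * g y * h x ≡ g y * h y * K y x
  transpose x y = begin
    K x y * g y * h x  ≡⟨ solve 3 (λ k a b → k :* a :* b := k :* b :* a) refl (K x y) (g y) (h x) ⟩
    K x y * h x * g y  ≡⟨ cong (_* g y) (K-h x y) ⟩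
    K x y * h y * g y  ≡⟨ cong (λ k → k * h y * g y) (K-sym x y) ⟩
    K y x * h y * g y  ≡⟨ solve 3 (λ k a b → k :* b :* a := a :* b :* k) refl (K y x) (g y) (h y) ⟩
    g y * h y * K y x  ∎
  row : ∀ y → y ∈ xs → ∑ xs (λ x → g y * h y * K y x) ≡ g y * h y
  row y y∈xs = trans (∑-*ˡ xs (g y * h y) (K y))
    (trans (cong (g y * h y *_) (K-rows y y∈xs)) (*-identityʳ (g y * h y)))

module Properties (n : ℕ) (V : Fin n → ℕ) where
  open Setting n V

  σ-least : ∀ {G} (C : SigmaAlg) → (∀ A → G A → mem C A) → σ[ G ] ⊑ C
  σ-least C G⊆C A (gen A∈G)     = G⊆C A A∈G
  σ-least C G⊆C B (g-resp A≗B a) = resp C A≗B (σ-least C G⊆C _ a)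
  σ-least C G⊆C _ g∅            = mem∅ C
  σ-least C G⊆C _ gV            = memV C
  σ-least C G⊆C _ (g∪ a b)      = mem∪ C (σ-least C G⊆C _ a) (σ-least C G⊆C _ b)
  σ-least C G⊆C _ (g∩ a b)      = mem∩ C (σ-least C G⊆C _ a) (σ-least C G⊆C _ b)
  σ-least C G⊆C _ (gᶜ a)        = memᶜ C (σ-least C G⊆C _ a)

  𝒜 : Subset n → SigmaAlg
  𝒜 e = record
    { mem  = In𝒜 e
    ; resp = λ { A≗B (E , A≡E) → E , λ x → trans (sym (A≗B x)) (A≡E x) }
    ; mem∅ = (λ _ → false) , (λ _ → refl)
    ; memV = (λ _ → true) , (λ _ → refl)
    ; mem∪ = λ { (E₁ , A≡E₁) (E₂ , B≡E₂) →
        (λ v → if E₁ v then true else E₂ v) , λ x → cong₂ (λ a b → if a then true else b) (A≡E₁ x) (B≡E₂ x) }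
    ; mem∩ = λ { (E₁ , A≡E₁) (E₂ , B≡E₂) → (λ v → E₁ v ∧ E₂ v) , λ x → cong₂ _∧_ (A≡E₁ x) (B≡E₂ x) }
    ; memᶜ = λ { (E , A≡E) → (λ v → if E v then false else true) , λ x → cong (λ a → if a then false else true) (A≡E x) }
    }

  ⋁-mono : ∀ {I : Set} {B B′ : I → SigmaAlg} → (∀ i → B i ⊑ B′ i) → ⋁ I B ⊑ ⋁ I B′
  ⋁-mono {I} {B′ = B′} B⊑B′ = σ-least (⋁ I B′) (λ { A (i , A∈Bi) → gen (i , B⊑B′ i A A∈Bi) })

  adjoin : SigmaAlg → PSet → SigmaAlg
  adjoin B A = σ[ (λ C → mem B C ⊎ C ≡ A) ]

  ⊑-adjoin : ∀ {B A} → B ⊑ adjoin B A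
  ⊑-adjoin C C∈B = gen (inj₁ C∈B)

  adjoin-⊑𝒜 : ∀ {B A e} → B ⊑𝒜 e → In𝒜 e A → adjoin B A ⊑𝒜 e
  adjoin-⊑𝒜 B⊑𝒜 A∈𝒜 = σ-least (𝒜 _) (λ { C (inj₁ C∈B) → B⊑𝒜 C C∈B ; C (inj₂ refl) → A∈𝒜 })

  generatedBy-adjoin : ∀ {B k} A → GeneratedBy B k → GeneratedBy (adjoin B A) (suc k)
  generatedBy-adjoin {B} {k} A (gs , B≈σgs) = gs′ , λ C → to C , from C
    where
    gs′ : Fin (suc k) → PSet
    gs′ fzero    = A
    gs′ (fsuc i) = gs i
    to : adjoin B A ⊑ σ[ (λ C → ∃ λ i → C ≡ gs′ i) ]
    to = σ-least σ[ _ ] λ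
      { C (inj₁ C∈B) → σ-least σ[ _ ] (λ { D (i , refl) → gen (fsuc i , refl) }) C (proj₁ (B≈σgs C) C∈B)
      ; C (inj₂ refl) → gen (fzero , refl) }
    from : σ[ (λ C → ∃ λ i → C ≡ gs′ i) ] ⊑ adjoin B A
    from = σ-least (adjoin B A) λ
      { C (fzero , refl)  → gen (inj₂ refl)
      ; C (fsuc i , refl) → gen (inj₁ (proj₂ (B≈σgs C) (gen (i , refl)))) }

  complex-adjoin : ∀ {B A c c′} → Complex B c → Complex (adjoin B A) c′ → c′ ℕ.≤ suc c
  complex-adjoin {B} {A} (B-gens , _) (_ , minimal) = minimal _ (generatedBy-adjoin {B} A B-gens)


  divℕ-as-* : ∀ q k → divℕ q k ≡ q * divℕ 1ℚ k
  divℕ-as-* q zero    = sym (*-zeroʳ q)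
  divℕ-as-* q (suc k) = cong (q *_) (sym (*-identityˡ _))

  divℕ-1-nonneg : ∀ k → 0ℚ ≤ divℕ 1ℚ k
  divℕ-1-nonneg zero    = ≤-refl
  divℕ-1-nonneg (suc k) = subst (0ℚ ≤_)
    (sym (trans (*-identityˡ _) (normalize-coprime (1-coprimeTo (suc k))))) (nonNegative⁻¹ _)

  fromℕ-*-divℕ : ∀ {k} → 0 ℕ.< k → fromℕ k * divℕ 1ℚ k ≡ 1ℚ
  fromℕ-*-divℕ {suc k} _ = trans (cong (fromℕ (suc k) *_) (*-identityˡ (ℤ.+ 1 / suc k))) (fromℕ-*-inverse k)

  fromℕ-*-divℕ-≤ : ∀ k → fromℕ k * divℕ 1ℚ k ≤ 1ℚ
  fromℕ-*-divℕ-≤ zero    = nonNegative⁻¹ 1ℚ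
  fromℕ-*-divℕ-≤ (suc k) = ≤-reflexive (fromℕ-*-divℕ {suc k} ℕ.z<s)

  weight : ℚ
  weight = divℕ 1ℚ (length allPoints)

  𝐄-as-∑ : ∀ f → 𝐄 f ≡ ∑ allPoints f * weight
  𝐄-as-∑ f = divℕ-as-* (∑ allPoints f) (length allPoints)

  𝐄-cong : ∀ {f g} → (∀ x → f x ≡ g x) → 𝐄 f ≡ 𝐄 g
  𝐄-cong f≡g = cong (λ s → divℕ s (length allPoints)) (∑-cong allPoints (λ x _ → f≡g x))

  𝐄-+ : ∀ f g → 𝐄 (λ x → f x + g x) ≡ 𝐄 f + 𝐄 g
  𝐄-+ f g = begin
    𝐄 (λ x → f x + g x)                      ≡⟨ 𝐄-as-∑ _ ⟩
    ∑ allPoints (λ x → f x + g x) * weight   ≡⟨ cong (_* weight) (∑-+ allPoints f g) ⟩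
    (∑ allPoints f + ∑ allPoints g) * weight ≡⟨ *-distribʳ-+ weight (∑ allPoints f) (∑ allPoints g) ⟩
    ∑ allPoints f * weight + ∑ allPoints g * weight ≡⟨ sym (cong₂ _+_ (𝐄-as-∑ f) (𝐄-as-∑ g)) ⟩
    𝐄 f + 𝐄 g                                ∎
    where open ≡-Reasoning

  𝐄-*ˡ : ∀ c f → 𝐄 (λ x → c * f x) ≡ c * 𝐄 f
  𝐄-*ˡ c f = begin
    𝐄 (λ x → c * f x)                     ≡⟨ 𝐄-as-∑ _ ⟩
    ∑ allPoints (λ x → c * f x) * weight  ≡⟨ cong (_* weight) (∑-*ˡ allPoints c f) ⟩
    c * ∑ allPoints f * weight            ≡⟨ *-assoc c (∑ allPoints f) weight ⟩
    c * (∑ allPoints f * weight)          ≡⟨ cong (c *_) (sym (𝐄-as-∑ f)) ⟩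
    c * 𝐄 f                               ∎
    where open ≡-Reasoning

  𝐄-mono : ∀ {f g} → (∀ x → f x ≤ g x) → 𝐄 f ≤ 𝐄 g
  𝐄-mono {f} {g} f≤g = subst₂ _≤_ (sym (𝐄-as-∑ f)) (sym (𝐄-as-∑ g))
    (*-monoʳ-≤-nonNeg weight {{nonNegative (divℕ-1-nonneg (length allPoints))}} (∑-mono allPoints f≤g))

  𝐄-0 : 𝐄 (λ _ → 0ℚ) ≡ 0ℚ
  𝐄-0 = trans (𝐄-as-∑ _) (trans (cong (_* weight) (∑-0 allPoints)) (*-zeroˡ weight))

  -- Only ≤, as divℕ q 0 = 0; this is why V_J need not be non-empty.
  𝐄-1≤1 : 𝐄 (λ _ → 1ℚ) ≤ 1ℚ
  𝐄-1≤1 = subst (_≤ 1ℚ) (sym (trans (𝐄-as-∑ _) (cong (_* weight) (∑-1 allPoints))))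
                (fromℕ-*-divℕ-≤ (length allPoints))

  𝐄-⊖ : ∀ f g → 𝐄 (λ x → f x - g x) ≡ 𝐄 f - 𝐄 g
  𝐄-⊖ f g = begin
    𝐄 (λ x → f x - g x)               ≡⟨ 𝐄-cong (λ x → solve 2 (λ a b → a :- b := a :+ con (- 1ℚ) :* b) refl (f x) (g x)) ⟩
    𝐄 (λ x → f x + - 1ℚ * g x)        ≡⟨ 𝐄-+ f _ ⟩
    𝐄 f + 𝐄 (λ x → - 1ℚ * g x)        ≡⟨ cong (𝐄 f +_) (𝐄-*ˡ (- 1ℚ) g) ⟩
    𝐄 f + - 1ℚ * 𝐄 g                  ≡⟨ solve 2 (λ a b → a :+ con (- 1ℚ) :* b := a :- b) refl (𝐄 f) (𝐄 g) ⟩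
    𝐄 f - 𝐄 g                         ∎
    where open ≡-Reasoning

  _⊖_ : (Point → ℚ) → (Point → ℚ) → Point → ℚ
  (f ⊖ g) x = f x - g x

  _⊛_ : ℚ → (Point → ℚ) → Point → ℚ
  (c ⊛ f) x = c * f x

  ⟨_,_⟩ : (Point → ℚ) → (Point → ℚ) → ℚ
  ⟨ f , g ⟩ = 𝐄 (λ x → f x * g x)

  ⟨⟩-nonneg : ∀ f → 0ℚ ≤ ⟨ f , f ⟩
  ⟨⟩-nonneg f = subst (_≤ ⟨ f , f ⟩) 𝐄-0 (𝐄-mono (λ x → square-nonneg (f x)))

  ⟨⊖⟩ˡ : ∀ f g h → ⟨ f ⊖ g , h ⟩ ≡ ⟨ f , h ⟩ - ⟨ g , h ⟩
  ⟨⊖⟩ˡ f g h = trans (𝐄-cong (λ x → solve 3 (λ a b c → (a :- b) :* c := a :* c :- b :* c) refl (f x) (g x) (h x)))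
                     (𝐄-⊖ _ _)

  ⟨⊖⊛⟩-expand : ∀ f g t →
    ⟨ f ⊖ (t ⊛ g) , f ⊖ (t ⊛ g) ⟩ ≡ ⟨ f , f ⟩ - (t + t) * ⟨ f , g ⟩ + t * t * ⟨ g , g ⟩
  ⟨⊖⊛⟩-expand f g t = begin
    ⟨ f ⊖ (t ⊛ g) , f ⊖ (t ⊛ g) ⟩
      ≡⟨ 𝐄-cong (λ x → expand (f x) (g x)) ⟩
    𝐄 (λ x → f x * f x - (t + t) * (f x * g x) + t * t * (g x * g x))
      ≡⟨ 𝐄-+ _ _ ⟩
    𝐄 (λ x → f x * f x - (t + t) * (f x * g x)) + 𝐄 (λ x → t * t * (g x * g x))
      ≡⟨ cong₂ _+_ (𝐄-⊖ _ _) (𝐄-*ˡ (t * t) _) ⟩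
    ⟨ f , f ⟩ - 𝐄 (λ x → (t + t) * (f x * g x)) + t * t * ⟨ g , g ⟩
      ≡⟨ cong (λ z → ⟨ f , f ⟩ - z + t * t * ⟨ g , g ⟩) (𝐄-*ˡ (t + t) _) ⟩
    ⟨ f , f ⟩ - (t + t) * ⟨ f , g ⟩ + t * t * ⟨ g , g ⟩
      ∎
    where
    open ≡-Reasoning
    expand : ∀ a b → (a - t * b) * (a - t * b) ≡ a * a - (t + t) * (a * b) + t * t * (b * b)
    expand a b = solve 3 (λ a b t → (a :- t :* b) :* (a :- t :* b) := a :* a :- (t :+ t) :* (a :* b) :+ t :* t :* (b :* b))
                       refl a b t

  pythagoras : ∀ f g → ⟨ f , g ⟩ ≡ ⟨ g , g ⟩ → ⟨ f ⊖ g , f ⊖ g ⟩ ≡ ⟨ f , f ⟩ - ⟨ g , g ⟩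
  pythagoras f g fg≡gg = begin
    ⟨ f ⊖ g , f ⊖ g ⟩
      ≡⟨ 𝐄-cong (λ x → cong (λ z → (f x - z) * (f x - z)) (sym (*-identityˡ (g x)))) ⟩
    ⟨ f ⊖ (1ℚ ⊛ g) , f ⊖ (1ℚ ⊛ g) ⟩
      ≡⟨ ⟨⊖⊛⟩-expand f g 1ℚ ⟩
    ⟨ f , f ⟩ - (1ℚ + 1ℚ) * ⟨ f , g ⟩ + 1ℚ * 1ℚ * ⟨ g , g ⟩
      ≡⟨ cong (λ z → ⟨ f , f ⟩ - (1ℚ + 1ℚ) * z + 1ℚ * 1ℚ * ⟨ g , g ⟩) fg≡gg ⟩
    ⟨ f , f ⟩ - (1ℚ + 1ℚ) * ⟨ g , g ⟩ + 1ℚ * 1ℚ * ⟨ g , g ⟩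
      ≡⟨ solve 2 (λ a b → a :- (con 1ℚ :+ con 1ℚ) :* b :+ con 1ℚ :* con 1ℚ :* b := a :- b) refl ⟨ f , f ⟩ ⟨ g , g ⟩ ⟩
    ⟨ f , f ⟩ - ⟨ g , g ⟩
      ∎
    where open ≡-Reasoning

  -- Expand 0 ≤ ⟨ f - δ g , f - δ g ⟩ at δ = ⟨ f , g ⟩.
  cauchy-schwarz : ∀ f g → ⟨ g , g ⟩ ≤ 1ℚ → ⟨ f , g ⟩ * ⟨ f , g ⟩ ≤ ⟨ f , f ⟩
  cauchy-schwarz f g gg≤1 = begin
    δ * δ
      ≡⟨ sym (+-identityˡ (δ * δ)) ⟩
    0ℚ + δ * δ
      ≤⟨ +-monoˡ-≤ (δ * δ) (⟨⟩-nonneg (f ⊖ (δ ⊛ g))) ⟩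
    ⟨ f ⊖ (δ ⊛ g) , f ⊖ (δ ⊛ g) ⟩ + δ * δ
      ≡⟨ cong (_+ δ * δ) (⟨⊖⊛⟩-expand f g δ) ⟩
    ⟨ f , f ⟩ - (δ + δ) * δ + δ * δ * ⟨ g , g ⟩ + δ * δ
      ≤⟨ +-monoˡ-≤ (δ * δ) (+-monoʳ-≤ (⟨ f , f ⟩ - (δ + δ) * δ)
           (*-monoˡ-≤-nonNeg (δ * δ) {{nonNegative (square-nonneg δ)}} gg≤1)) ⟩
    ⟨ f , f ⟩ - (δ + δ) * δ + δ * δ * 1ℚ + δ * δ
      ≡⟨ solve 2 (λ a d → a :- (d :+ d) :* d :+ d :* d :* con 1ℚ :+ d :* d := a) refl ⟨ f , f ⟩ δ ⟩
    ⟨ f , f ⟩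
      ∎
    where
    open ≤-Reasoning
    δ = ⟨ f , g ⟩

  count : PSet → ℕ
  count A = length (filter (T? ∘ A) allPoints)

  count-cong : ∀ {A C} → (∀ z → A z ≡ C z) → count A ≡ count C
  count-cong A≡C = cong length
    (filter-≐ _ _ ((λ {z} → subst T (A≡C z)) , (λ {z} → subst T (sym (A≡C z)))) allPoints)

  count-pos : ∀ {A x} → x ∈ allPoints → A x ≡ true → 0 ℕ.< count A
  count-pos x∈ Ax = filter-some _ (lose x∈ (subst T (sym Ax) tt))

  -- avgOver filters with its own decider of T; filter-≐ identifies the two counts.
  avgOver-as-count : ∀ A g → avgOver A g ≡ divℕ (∑ allPoints (λ y → 𝟙 A y * g y)) (count A)
  avgOver-as-count A g = cong (divℕ _) (cong length (filter-≐ _ _ (id , id) allPoints))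

  avgOver-cong : ∀ {A C} g → (∀ z → A z ≡ C z) → avgOver A g ≡ avgOver C g
  avgOver-cong {A} {C} g A≡C = begin
    avgOver A g                                       ≡⟨ avgOver-as-count A g ⟩
    divℕ (∑ allPoints (λ y → 𝟙 A y * g y)) (count A)  ≡⟨ cong₂ divℕ (∑-cong allPoints (λ y _ → cong (λ b → 𝟏 b * g y) (A≡C y)))
                                                                  (count-cong A≡C) ⟩
    divℕ (∑ allPoints (λ y → 𝟙 C y * g y)) (count C)  ≡⟨ sym (avgOver-as-count C g) ⟩
    avgOver C g                                       ∎
    where open ≡-Reasoning

  atomKernel : (Point → PSet) → Point → Point → ℚ
  atomKernel α x y = 𝟙 (α x) y * divℕ 1ℚ (count (α x))

  condE-as-kernel : ∀ α g x → condE α g x ≡ ∑ allPoints (λ y → atomKernel α x y * g y)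
  condE-as-kernel α g x = begin
    avgOver (α x) g                                 ≡⟨ avgOver-as-count (α x) g ⟩
    divℕ (∑ allPoints (λ y → 𝟙 (α x) y * g y)) N   ≡⟨ divℕ-as-* _ N ⟩
    ∑ allPoints (λ y → 𝟙 (α x) y * g y) * w        ≡⟨ sym (∑-*ʳ allPoints _ w) ⟩
    ∑ allPoints (λ y → 𝟙 (α x) y * g y * w)        ≡⟨ ∑-cong allPoints (λ y _ → swap (𝟙 (α x) y) (g y)) ⟩
    ∑ allPoints (λ y → atomKernel α x y * g y)     ∎
    where
    open ≡-Reasoning
    N = count (α x)
    w = divℕ 1ℚ N
    swap : ∀ a b → a * b * w ≡ a * w * b
    swap a b = solve 3 (λ a b w → a :* b :* w := a :* w :* b) refl a b w

  module Atoms {B : SigmaAlg} {α : Point → PSet} (α-atoms : AtomMap B α) where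

    atom∈ : ∀ x → mem B (α x)
    atom∈ x = proj₁ (proj₁ (α-atoms x))

    atom-self : ∀ x → α x x ≡ true
    atom-self x = proj₂ (α-atoms x)

    -- α x ∩ A is a non-empty measurable part of the atom α x, hence all of it.
    atom⊆ : ∀ {A x} → mem B A → A x ≡ true → α x ⊆ₛ A
    atom⊆ {A} {x} A∈B Ax y xy = ∧-conicalʳ (α x y) (A y)
      (proj₂ (proj₂ (proj₁ (α-atoms x))) (α x ∩ₛ A) (mem∩ B (atom∈ x) A∈B)
        (x , cong₂ _∧_ (atom-self x) Ax) (λ z → ∧-conicalˡ (α x z) (A z)) y xy)

    atom-sym : ∀ {x y} → α x y ≡ true → α y x ≡ true
    atom-sym {x} {y} xy with α y x in yx
    ... | true  = refl
    -- Otherwise x, hence also y, lies in the measurable complement of α y.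
    ... | false = trans (sym (cong (λ b → if b then false else true) (atom-self y)))
                        (atom⊆ (memᶜ B (atom∈ y)) (cong (λ b → if b then false else true) yx) y xy)

    atom-≡ : ∀ x y → α x y ≡ α y x
    atom-≡ x y = ⇔→≡ (mk⇔ atom-sym atom-sym)

    atom-≐ : ∀ {x y} → α x y ≡ true → ∀ z → α x z ≡ α y z
    atom-≐ xy z = ⇔→≡ (mk⇔ (atom⊆ (atom∈ _) (atom-sym xy) z) (atom⊆ (atom∈ _) xy z))

    measurable-constant : ∀ {A x y} → mem B A → α x y ≡ true → A x ≡ A y
    measurable-constant {A} {x} {y} A∈B xy =
      ⇔→≡ (mk⇔ (λ Ax → atom⊆ A∈B Ax y xy) (λ Ay → atom⊆ A∈B Ay x (atom-sym xy)))

    condE-constant : ∀ g {x y} → α x y ≡ true → condE α g x ≡ condE α g y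
    condE-constant g xy = avgOver-cong g (atom-≐ xy)

    kernel-sym : ∀ x y → atomKernel α x y ≡ atomKernel α y x
    kernel-sym x y = trans (𝟏-*-cong (α x y) (λ xy → cong (divℕ 1ℚ) (count-cong (atom-≐ xy))))
                           (cong (λ b → 𝟏 b * divℕ 1ℚ (count (α y))) (atom-≡ x y))

    kernel-rows : ∀ y → y ∈ allPoints → ∑ allPoints (atomKernel α y) ≡ 1ℚ
    kernel-rows y y∈ = begin
      ∑ allPoints (atomKernel α y)                   ≡⟨ ∑-*ʳ allPoints (𝟙 (α y)) _ ⟩
      ∑ allPoints (𝟙 (α y)) * divℕ 1ℚ (count (α y))  ≡⟨ cong (_* divℕ 1ℚ (count (α y))) (∑-𝟏 allPoints (α y)) ⟩
      fromℕ (count (α y)) * divℕ 1ℚ (count (α y))    ≡⟨ fromℕ-*-divℕ (count-pos y∈ (atom-self y)) ⟩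
      1ℚ                                             ∎
      where open ≡-Reasoning

    kernel-constant : ∀ {h : Point → ℚ} → (∀ {x y} → α x y ≡ true → h x ≡ h y) →
                      ∀ x y → atomKernel α x y * h x ≡ atomKernel α x y * h y
    kernel-constant {h} h-const x y = begin
      𝟙 (α x) y * c * h x    ≡⟨ *-assoc (𝟙 (α x) y) c (h x) ⟩
      𝟙 (α x) y * (c * h x)  ≡⟨ 𝟏-*-cong (α x y) (λ xy → cong (c *_) (h-const {x} {y} xy)) ⟩
      𝟙 (α x) y * (c * h y)  ≡⟨ sym (*-assoc (𝟙 (α x) y) c (h y)) ⟩
      𝟙 (α x) y * c * h y    ∎
      where
      open ≡-Reasoning
      c = divℕ 1ℚ (count (α x))

    condE-adjoint : ∀ {h : Point → ℚ} → (∀ {x y} → α x y ≡ true → h x ≡ h y) →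
                    ∀ g → ⟨ condE α g , h ⟩ ≡ ⟨ g , h ⟩
    condE-adjoint {h} h-const g = cong (λ s → divℕ s (length allPoints)) (trans
      (∑-cong allPoints (λ x _ → cong (_* h x) (condE-as-kernel α g x)))
      (∑-kernel-adjoint allPoints (atomKernel α) g h kernel-sym kernel-rows (kernel-constant h-const)))

  atoms-unique : ∀ {B α β} → AtomMap B α → AtomMap B β → ∀ x z → α x z ≡ β x z
  atoms-unique {B} {α} {β} α-atoms β-atoms x z =
    ⇔→≡ (mk⇔ (α.atom⊆ (β.atom∈ x) (β.atom-self x) z) (β.atom⊆ (α.atom∈ x) (α.atom-self x) z))
    where
    module α = Atoms {B} {α} α-atoms
    module β = Atoms {B} {β} β-atoms

  atoms-refine : ∀ {B B′ α α′} → B ⊑ B′ → AtomMap B α → AtomMap B′ α′ →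
                 ∀ {x y} → α′ x y ≡ true → α x y ≡ true
  atoms-refine {B} {B′} {α} {α′} B⊑B′ α-atoms α′-atoms {x} {y} =
    α′.atom⊆ (B⊑B′ _ (α.atom∈ x)) (α.atom-self x) y
    where
    module α = Atoms {B} {α} α-atoms
    module α′ = Atoms {B′} {α′} α′-atoms

  condE-unique : ∀ {B α β} → AtomMap B α → AtomMap B β → ∀ g x → condE α g x ≡ condE β g x
  condE-unique {B} α-atoms β-atoms g x = avgOver-cong g (atoms-unique {B} α-atoms β-atoms x)

  prodSkel-norm≤1 : ∀ e Ef → ⟨ prodSkel e Ef , prodSkel e Ef ⟩ ≤ 1ℚ
  prodSkel-norm≤1 e Ef = ≤-trans (𝐄-mono square≤1) 𝐄-1≤1
    where
    square≤1 : ∀ x → prodSkel e Ef x * prodSkel e Ef x ≤ 1ℚ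
    square≤1 x = subst (λ q → q * q ≤ 1ℚ) (sym (∏-𝟏 (λ f → Ef f x) (skeletonList e)))
                       (𝟏*𝟏≤1 (all (λ f → Ef f x) (skeletonList e)))

  prodSkel-constant : ∀ {B α} → AtomMap B α → ∀ e Ef → (∀ f → f ∈ skeletonList e → mem B (Ef f)) →
                      ∀ {x y} → α x y ≡ true → prodSkel e Ef x ≡ prodSkel e Ef y
  prodSkel-constant {B} {α} α-atoms e Ef Ef∈B xy = cong (foldr _*_ 1ℚ) (map-cong-local
    (tabulate (λ {f} f∈ → cong 𝟏 (Atoms.measurable-constant {B} {α} α-atoms (Ef∈B f f∈) xy))))

  energy-gain : ∀ {B B′ α α′} → B ⊑ B′ → AtomMap B α → AtomMap B′ α′ →
    ∀ {P} → (∀ {x y} → α′ x y ≡ true → P x ≡ P y) → ⟨ P , P ⟩ ≤ 1ℚ → ∀ g →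
    ⟨ condE α g , condE α g ⟩ + ⟨ g ⊖ condE α g , P ⟩ * ⟨ g ⊖ condE α g , P ⟩ ≤ ⟨ condE α′ g , condE α′ g ⟩
  energy-gain {B} {B′} {α} {α′} B⊑B′ α-atoms α′-atoms {P} P-constant PP≤1 g = begin
    ⟨ u , u ⟩ + ⟨ g ⊖ u , P ⟩ * ⟨ g ⊖ u , P ⟩      ≡⟨ cong (λ d → ⟨ u , u ⟩ + d * d) δ≡ ⟩
    ⟨ u , u ⟩ + ⟨ u′ ⊖ u , P ⟩ * ⟨ u′ ⊖ u , P ⟩    ≤⟨ +-monoʳ-≤ ⟨ u , u ⟩ (cauchy-schwarz (u′ ⊖ u) P PP≤1) ⟩
    ⟨ u , u ⟩ + ⟨ u′ ⊖ u , u′ ⊖ u ⟩                ≡⟨ cong (⟨ u , u ⟩ +_) (pythagoras u′ u u′u≡uu) ⟩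
    ⟨ u , u ⟩ + (⟨ u′ , u′ ⟩ - ⟨ u , u ⟩)           ≡⟨ solve 2 (λ a b → a :+ (b :- a) := b) refl ⟨ u , u ⟩ ⟨ u′ , u′ ⟩ ⟩
    ⟨ u′ , u′ ⟩                                     ∎
    where
    open ≤-Reasoning
    module α = Atoms {B} {α} α-atoms
    module α′ = Atoms {B′} {α′} α′-atoms
    u u′ : Point → ℚ
    u = condE α g
    u′ = condE α′ g
    u′u≡uu : ⟨ u′ , u ⟩ ≡ ⟨ u , u ⟩
    u′u≡uu = trans (α′.condE-adjoint (λ xy → α.condE-constant g (atoms-refine {B} {B′} B⊑B′ α-atoms α′-atoms xy)) g)
                   (sym (α.condE-adjoint (α.condE-constant g) g))
    δ≡ : ⟨ g ⊖ u , P ⟩ ≡ ⟨ u′ ⊖ u , P ⟩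
    δ≡ = begin-equality
      ⟨ g ⊖ u , P ⟩            ≡⟨ ⟨⊖⟩ˡ g u P ⟩
      ⟨ g , P ⟩ - ⟨ u , P ⟩    ≡⟨ cong (_- ⟨ u , P ⟩) (sym (α′.condE-adjoint P-constant g)) ⟩
      ⟨ u′ , P ⟩ - ⟨ u , P ⟩   ≡⟨ sym (⟨⊖⟩ˡ u′ u P) ⟩
      ⟨ u′ ⊖ u , P ⟩           ∎

lemma2p4 : (n : ℕ) (V : Fin n → ℕ) → (∀ j → NonZero (V j)) →
    let open Setting n V in
    (e : Subset n) (E : PSet) → In𝒜 e E →
    (B : ∂ e → SigmaAlg) → (∀ f → B f ⊑𝒜 proj₁ f) →
    (ε : ℚ) → 0ℚ < ε →
    DiscrepancyAtLeast e E (⋁ (∂ e) B) ε →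
    ∃ λ (B′ : ∂ e → SigmaAlg) →
      (∀ f → (B f ⊑ B′ f) × (B′ f ⊑𝒜 proj₁ f)
           × (∀ c c′ → Complex (B f) c → Complex (B′ f) c′ → c′ Data.Nat.≤ suc c))
      × (∀ α α′ → AtomMap (⋁ (∂ e) B) α → AtomMap (⋁ (∂ e) B′) α′ →
           energy α E + ε * ε ≤ energy α′ E)
lemma2p4 n V _ e E _ B B⊑𝒜 ε 0<ε (α₀ , α₀-atoms , Ef , Ef∈𝒜 , ε≤∣δ∣) =
  B′ , (λ f → B⊑B′ f , adjoin-⊑𝒜 {B f} (B⊑𝒜 f) (Ef∈𝒜 f) , λ _ _ → complex-adjoin {B f}) , gain
  where
  open Setting n V
  open Properties n V
  B′ : ∂ e → SigmaAlg
  B′ f = adjoin (B f) (Ef (proj₁ f))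
  B⊑B′ : ∀ f → B f ⊑ B′ f
  B⊑B′ f = ⊑-adjoin {B f}
  P : Point → ℚ
  P = prodSkel e Ef
  Ef∈⋁B′ : ∀ f → f ∈ skeletonList e → mem (⋁ (∂ e) B′) (Ef f)
  Ef∈⋁B′ f f∈ = gen ((f , proj₂ (∈-filter⁻ _ {xs = allSubsets n} f∈)) , gen (inj₂ refl))
  gain : ∀ α α′ → AtomMap (⋁ (∂ e) B) α → AtomMap (⋁ (∂ e) B′) α′ → energy α E + ε * ε ≤ energy α′ E
  gain α α′ α-atoms α′-atoms = ≤-trans (+-monoʳ-≤ (energy α E) ε²≤δ²)
    (energy-gain {⋁ (∂ e) B} {⋁ (∂ e) B′} (⋁-mono {∂ e} {B} {B′} B⊑B′) α-atoms α′-atoms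
                 (prodSkel-constant {⋁ (∂ e) B′} α′-atoms e Ef Ef∈⋁B′) (prodSkel-norm≤1 e Ef) (𝟙 E))
    where
    ε²≤δ² : ε * ε ≤ ⟨ 𝟙 E ⊖ condE α (𝟙 E) , P ⟩ * ⟨ 𝟙 E ⊖ condE α (𝟙 E) , P ⟩
    ε²≤δ² = subst (λ d → ε * ε ≤ d * d)
      (𝐄-cong (λ x → cong (λ z → (𝟙 E x - z) * P x) (condE-unique {⋁ (∂ e) B} α₀-atoms α-atoms (𝟙 E) x)))
      (square-≤-∣∣ (<⇒≤ 0<ε) ε≤∣δ∣)
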